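{- Let $m,n$ be integers with $m\equiv 0 \pmod 5$ and $n\equiv 0\pmod 5$, and let $k\ge1$ be an integer. Then \[\gamma_{[k]R}(C_m\square C_n)=(k+1)\gamma(C_m\square C_n)=(k+1)\frac{mn}{5}.\]
   Context: $C_m$ denotes the cycle on $m$ vertices and $\square$ the Cartesian product of graphs; $\gamma$ denotes the domination number. For an integer $k\ge1$ and a labeling $f:V(G)\to\{0,1,\dots,k+1\}$, let $AN(v)=\{u\in N(v): f(u)>0\}$. The labeling $f$ is a $[k]$-Roman dominating function if every vertex $v$ with $f(v)<k$ satisfies $f(N[v])\ge k+|AN(v)|$, where $N[v]=N(v)\cup\{v\}$ and $f(X)=\sum_{x\in X}f(x)$. $\gamma_{[k]R}(G)$ is the minimum of $\sum_{v}f(v)$ over all $[k]$-Roman dominating functions $f$ on $G$. -}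

module Defs where

open import Data.Nat using (ℕ; zero; suc; _+_; _*_; _∸_; _≤_; _<_; _≡ᵇ_; _<ᵇ_)
open import Data.Nat.Divisibility using (_∣_)
open import Data.Fin using (Fin; toℕ; quotRem) renaming (zero to fz; suc to fs)
open import Data.Bool using (Bool; true; false; _∧_; _∨_; if_then_else_; T)
open import Data.Product using (_×_; _,_; Σ; proj₁; proj₂)
open import Data.Sum using (_⊎_)
open import Relation.Binary.PropositionalEquality using (_≡_)

record Graph : Set where
  field
    order : ℕ
    Adj   : Fin order → Fin order → Bool
open Graph public

∑ : ∀ {N} → (Fin N → ℕ) → ℕ
∑ {zero}  f = 0
∑ {suc N} f = f fz + ∑ (λ i → f (fs i))

cycAdj : ∀ {m} → Fin m → Fin m → Bool
cycAdj {m} i j =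
  step (toℕ i) (toℕ j) ∨ step (toℕ j) (toℕ i)
  where
  step : ℕ → ℕ → Bool
  step a b = (b ≡ᵇ suc a) ∨ ((a ≡ᵇ (m ∸ 1)) ∧ (b ≡ᵇ 0))

C : ℕ → Graph
C m = record { order = m ; Adj = cycAdj }

-- Cartesian product G □ H; vertex v : Fin (|G| * |H|) encodes the pair
-- (g , h) with (h , g) = quotRem |H| v (a bijection Fin (a*b) ≃ Fin b × Fin a).
_□_ : Graph → Graph → Graph
G □ H = record { order = order G * order H ; Adj = adj }
  where
  adj : Fin (order G * order H) → Fin (order G * order H) → Bool
  adj v w with quotRem (order H) v | quotRem (order H) w
  ... | (h , g) | (h' , g') =
    (eqF g g' ∧ Adj H h h') ∨ (eqF h h' ∧ Adj G g g')
    where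
    eqF : ∀ {n} → Fin n → Fin n → Bool
    eqF x y = toℕ x ≡ᵇ toℕ y

card : ∀ {N} → (Fin N → Bool) → ℕ
card S = ∑ (λ v → if S v then 1 else 0)

IsDominating : (G : Graph) → (Fin (order G) → Bool) → Set
IsDominating G D = ∀ v → T (D v) ⊎ Σ (Fin (order G)) (λ u → T (Adj G v u) × T (D u))

DominationNumber : Graph → ℕ → Set
DominationNumber G d =
  Σ (Fin (order G) → Bool) (λ D → IsDominating G D × card D ≡ d)
  × (∀ D → IsDominating G D → d ≤ card D)

weight : (G : Graph) → (Fin (order G) → ℕ) → ℕ
weight G f = ∑ f

closedNbhdSum : (G : Graph) → (Fin (order G) → ℕ) → Fin (order G) → ℕ
closedNbhdSum G f v = f v + ∑ (λ u → if Adj G v u then f u else 0)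

activeNbrs : (G : Graph) → (Fin (order G) → ℕ) → Fin (order G) → ℕ
activeNbrs G f v = ∑ (λ u → if Adj G v u ∧ (0 <ᵇ f u) then 1 else 0)

Is[k]RDF : ℕ → (G : Graph) → (Fin (order G) → ℕ) → Set
Is[k]RDF k G f =
  (∀ v → f v ≤ suc k)
  × (∀ v → f v < k → k + activeNbrs G f v ≤ closedNbhdSum G f v)

[k]RomanDominationNumber : ℕ → Graph → ℕ → Set
[k]RomanDominationNumber k G d =
  Σ (Fin (order G) → ℕ) (λ f → Is[k]RDF k G f × weight G f ≡ d)
  × (∀ f → Is[k]RDF k G f → d ≤ weight G f)

-- Let f be a [k]-RDF on an r-regular graph with n vertices, r ≥ 2. Summing f(N[v]) over all v counts
-- every label r + 1 times, and f(N[v]) ≥ k + 1 for every v except the lonely vertices: those labelled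
-- exactly k with no labelled neighbour, which fall short by one. Each neighbour v of a lonely vertex is
-- unlabelled, so the [k]-RDF condition forces at least two active neighbours and f(N[v]) ≥ k + |AN(v)|;
-- this leaves v a surplus of J(v)/r when it has J(v) lonely neighbours, which pays for all shortfalls.
-- Hence (r + 1) w(f) ≥ (k + 1) n. Labelling a dominating set D by k + 1 gives a [k]-RDF of weight
-- (k + 1)|D|, so both bounds are attained by a perfect code (a set meeting every closed neighbourhood
-- exactly once, hence of size n/(r + 1)). On the 4-regular torus C_m □ C_n with 5 ∣ m and 5 ∣ n the
-- vertices (i , j) with i + 2j ≡ 0 (mod 5) form one: the closed neighbourhood of (i , j) carries the
-- residues of i + 2j, i + 2j + 1, …, i + 2j + 4.

module Submission where

open import Defs
open import Data.Nat
  using (ℕ; zero; suc; pred; _+_; _*_; _≤_; _<_; _≡ᵇ_; _<ᵇ_; _%_; _/_; z≤n; s≤s; z<s; NonZero; >-nonZero; >-nonZero⁻¹)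
open import Data.Nat.Properties
open import Data.Nat.Divisibility using (_∣_; n∣m⇒m%n≡0)
open import Data.Nat.DivMod using (%-distribˡ-+; %-distribˡ-*; %-pred-≡0; [m+n]%n≡m%n; m<n⇒m%n≡m; m*n/n≡m)
open import Data.Nat.Tactic.RingSolver using (solve-∀)
open import Data.Fin using (Fin; zero; suc; toℕ; fromℕ<; combine; remQuot; quotRem; _↑ˡ_; _↑ʳ_)
open import Data.Fin.Properties using (toℕ<n; toℕ-fromℕ<; toℕ-injective; remQuot-combine; combine-remQuot)
open import Data.Bool using (Bool; true; false; _∧_; _∨_; if_then_else_; T)
open import Data.Bool.Properties using (∨-comm; ∨-identityʳ; ∧-zeroʳ; if-∧; if-cong)
open import Data.Product using (_×_; _,_; proj₁; proj₂; ∃-syntax; swap; uncurry)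
open import Data.Sum using (inj₁; inj₂)
open import Data.Unit using (tt)
open import Function using (_∘_; flip)
open import Relation.Nullary using (contradiction; proof)
open import Relation.Binary.Definitions using (tri<; tri≈; tri>)
open import Relation.Nullary.Reflects using (Reflects; ofʸ; ofⁿ; det; fromEquivalence; _×-reflects_)
open import Relation.Binary.PropositionalEquality
open import Algebra.Properties.Semiring.Sum +-*-semiring as Sum using (sum; sum-cong-≗)

≡ᵇ-reflects : ∀ a b → Reflects (a ≡ b) (a ≡ᵇ b)
≡ᵇ-reflects a b = proof (a ≟ b)

≢⇒≡ᵇ≡false : ∀ {a b} → a ≢ b → (a ≡ᵇ b) ≡ false
≢⇒≡ᵇ≡false {a} {b} a≢b = det (≡ᵇ-reflects a b) (ofⁿ a≢b)

≡ᵇ-refl : ∀ a → (a ≡ᵇ a) ≡ true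
≡ᵇ-refl a = det (≡ᵇ-reflects a a) (ofʸ refl)

≡ᵇ-sym : ∀ a b → (a ≡ᵇ b) ≡ (b ≡ᵇ a)
≡ᵇ-sym zero    zero    = refl
≡ᵇ-sym zero    (suc b) = refl
≡ᵇ-sym (suc a) zero    = refl
≡ᵇ-sym (suc a) (suc b) = ≡ᵇ-sym a b

-- The equality test that `_□_` applies to coordinates.
_=ᵇ_ : ∀ {n} → Fin n → Fin n → Bool
i =ᵇ j = toℕ i ≡ᵇ toℕ j

=ᵇ-reflects : ∀ {n} (i j : Fin n) → Reflects (i ≡ j) (i =ᵇ j)
=ᵇ-reflects i j = fromEquivalence (toℕ-injective ∘ ≡ᵇ⇒≡ _ _) (≡⇒≡ᵇ _ _ ∘ cong toℕ)

=ᵇ-disjoint : ∀ {n} {a b : Fin n} → a ≢ b → ∀ j → (a =ᵇ j) ∧ (b =ᵇ j) ≡ false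
=ᵇ-disjoint {a = a} {b} a≢b j =
  det (=ᵇ-reflects a j ×-reflects =ᵇ-reflects b j) (ofⁿ λ (a≡j , b≡j) → a≢b (trans a≡j (sym b≡j)))

if-T : ∀ {b} {x y : ℕ} → T b → (if b then x else y) ≡ x
if-T {true} _ = refl

if-positive : ∀ b {x} → 0 < (if b then x else 0) → T b × 0 < x
if-positive true 0<x = tt , 0<x

if-distrib-+ : ∀ b {x y} → (if b then x + y else 0) ≡ (if b then x else 0) + (if b then y else 0)
if-distrib-+ true  = refl
if-distrib-+ false = refl

if-distribˡ-* : ∀ b c {x} → c * (if b then x else 0) ≡ (if b then c * x else 0)
if-distribˡ-* true  c = refl
if-distribˡ-* false c = *-zeroʳ c

if-as-* : ∀ b c → (if b then c else 0) ≡ c * (if b then 1 else 0)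
if-as-* true  c = sym (*-identityʳ c)
if-as-* false c = sym (*-zeroʳ c)

if-mono-≤ : ∀ b {x y} → x ≤ y → (if b then x else 0) ≤ (if b then y else 0)
if-mono-≤ true  x≤y = x≤y
if-mono-≤ false _   = z≤n

if-∨-disjoint : ∀ b c {x} → b ∧ c ≡ false →
                (if b ∨ c then x else 0) ≡ (if b then x else 0) + (if c then x else 0)
if-∨-disjoint true  false {x} _ = sym (+-identityʳ x)
if-∨-disjoint false c         _ = refl

∑≡sum : ∀ {N} (f : Fin N → ℕ) → ∑ f ≡ sum f
∑≡sum {zero}  f = refl
∑≡sum {suc N} f = cong (f zero +_) (∑≡sum (f ∘ suc))

∑-cong : ∀ {N} {f g : Fin N → ℕ} → (∀ i → f i ≡ g i) → ∑ f ≡ ∑ g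
∑-cong {f = f} {g} f≗g rewrite ∑≡sum f | ∑≡sum g = sum-cong-≗ f≗g

∑-distrib-+ : ∀ {N} (f g : Fin N → ℕ) → ∑ (λ i → f i + g i) ≡ ∑ f + ∑ g
∑-distrib-+ f g rewrite ∑≡sum (λ i → f i + g i) | ∑≡sum f | ∑≡sum g = Sum.∑-distrib-+ f g

∑-distribˡ-* : ∀ {N} c (f : Fin N → ℕ) → c * ∑ f ≡ ∑ (λ i → c * f i)
∑-distribˡ-* c f rewrite ∑≡sum f | ∑≡sum (λ i → c * f i) = Sum.*-distribˡ-sum c f

∑-comm : ∀ {M N} (F : Fin M → Fin N → ℕ) → ∑ (λ i → ∑ (F i)) ≡ ∑ (λ j → ∑ (λ i → F i j))
∑-comm F = trans (∑∑≡sum-sum F) (trans (Sum.∑-comm F) (sym (∑∑≡sum-sum (flip F))))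
  where
  ∑∑≡sum-sum : ∀ {M N} (F : Fin M → Fin N → ℕ) → ∑ (λ i → ∑ (F i)) ≡ sum (λ i → sum (F i))
  ∑∑≡sum-sum F = trans (∑≡sum (λ i → ∑ (F i))) (sum-cong-≗ (∑≡sum ∘ F))

∑-const : ∀ N c → ∑ {N} (λ _ → c) ≡ N * c
∑-const zero    c = refl
∑-const (suc N) c = cong (c +_) (∑-const N c)

∑-zero : ∀ N → ∑ {N} (λ _ → 0) ≡ 0
∑-zero N = trans (∑-const N 0) (*-zeroʳ N)

∑-mono-≤ : ∀ {N} {f g : Fin N → ℕ} → (∀ i → f i ≤ g i) → ∑ f ≤ ∑ g
∑-mono-≤ {zero}  f≤g = z≤n
∑-mono-≤ {suc N} f≤g = +-mono-≤ (f≤g zero) (∑-mono-≤ (f≤g ∘ suc))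

term≤∑ : ∀ {N} (f : Fin N → ℕ) i → f i ≤ ∑ f
term≤∑ f zero    = m≤m+n _ _
term≤∑ f (suc i) = ≤-trans (term≤∑ (f ∘ suc) i) (m≤n+m _ _)

∑-positive : ∀ {N} (f : Fin N → ℕ) → 0 < ∑ f → ∃[ i ] 0 < f i
∑-positive {suc N} f 0<∑ with f zero in f₀≡
... | suc _ = zero , subst (0 <_) (sym f₀≡) z<s
... | zero  = let i , 0<fi = ∑-positive (f ∘ suc) 0<∑ in suc i , 0<fi

∑-if : ∀ {N} b (f : Fin N → ℕ) → ∑ (λ i → if b then f i else 0) ≡ (if b then ∑ f else 0)
∑-if {N} true  f = refl
∑-if {N} false f = ∑-zero N

∑-=ᵇ : ∀ {N} (i : Fin N) (f : Fin N → ℕ) → ∑ (λ j → if i =ᵇ j then f j else 0) ≡ f i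
∑-=ᵇ {suc N} zero    f = trans (cong (f zero +_) (∑-zero N)) (+-identityʳ _)
∑-=ᵇ {suc N} (suc i) f = ∑-=ᵇ i (f ∘ suc)

∑-=ᵇ-∧ : ∀ {M N} (i : Fin M) (P : Fin N → Bool) (F : Fin M → Fin N → ℕ) →
         ∑ (λ j → ∑ (λ l → if (i =ᵇ j) ∧ P l then F j l else 0)) ≡ ∑ (λ l → if P l then F i l else 0)
∑-=ᵇ-∧ i P F = begin
  ∑ (λ j → ∑ (λ l → if (i =ᵇ j) ∧ P l then F j l else 0))
    ≡⟨ ∑-cong (λ j → trans (∑-cong (λ l → if-∧ (i =ᵇ j) {P l}))
                           (∑-if (i =ᵇ j) (λ l → if P l then F j l else 0))) ⟩
  ∑ (λ j → if i =ᵇ j then ∑ (λ l → if P l then F j l else 0) else 0)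
    ≡⟨ ∑-=ᵇ i (λ j → ∑ (λ l → if P l then F j l else 0)) ⟩
  ∑ (λ l → if P l then F i l else 0) ∎
  where open ≡-Reasoning

∑-++ : ∀ {a b} (f : Fin (a + b) → ℕ) → ∑ f ≡ ∑ (λ i → f (i ↑ˡ b)) + ∑ (λ j → f (a ↑ʳ j))
∑-++ {zero}      f = refl
∑-++ {suc a} {b} f = trans (cong (f zero +_) (∑-++ {a} {b} (f ∘ suc))) (sym (+-assoc (f zero) _ _))

∑-combine : ∀ {a b} (f : Fin (a * b) → ℕ) → ∑ f ≡ ∑ (λ i → ∑ (λ j → f (combine {a} {b} i j)))
∑-combine {zero}      f = refl
∑-combine {suc a} {b} f =
  trans (∑-++ {b} {a * b} f) (cong (∑ (λ j → f (j ↑ˡ (a * b))) +_) (∑-combine {a} {b} (f ∘ (b ↑ʳ_))))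

nbrSum : (G : Graph) → (Fin (order G) → ℕ) → Fin (order G) → ℕ
nbrSum G x v = ∑ (λ u → if Adj G v u then x u else 0)

indicator : ∀ {N} → (Fin N → Bool) → Fin N → ℕ
indicator D v = if D v then 1 else 0

support : ∀ {N} → (Fin N → ℕ) → Fin N → Bool
support f u = 0 <ᵇ f u

degree : (G : Graph) → Fin (order G) → ℕ
degree G = nbrSum G (λ _ → 1)

IsSymmetric : Graph → Set
IsSymmetric G = ∀ v w → Adj G v w ≡ Adj G w v

IsLoopless : Graph → Set
IsLoopless G = ∀ v → Adj G v v ≡ false

IsRegular : ℕ → Graph → Set
IsRegular r G = ∀ v → degree G v ≡ r

module NeighbourSums (G : Graph) where

  nbrSum-cong : ∀ {x y} → (∀ u → x u ≡ y u) → ∀ v → nbrSum G x v ≡ nbrSum G y v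
  nbrSum-cong x≗y v = ∑-cong (λ u → cong (if Adj G v u then_else 0) (x≗y u))

  nbrSum-distrib-+ : ∀ x y v → nbrSum G (λ u → x u + y u) v ≡ nbrSum G x v + nbrSum G y v
  nbrSum-distrib-+ x y v = trans (∑-cong (λ u → if-distrib-+ (Adj G v u)))
    (∑-distrib-+ (λ u → if Adj G v u then x u else 0) (λ u → if Adj G v u then y u else 0))

  nbrSum-distribˡ-* : ∀ c x v → c * nbrSum G x v ≡ nbrSum G (λ u → c * x u) v
  nbrSum-distribˡ-* c x v =
    trans (∑-distribˡ-* c (λ u → if Adj G v u then x u else 0)) (∑-cong (λ u → if-distribˡ-* (Adj G v u) c))

  nbrSum-mono-≤ : ∀ {x y} → (∀ u → x u ≤ y u) → ∀ v → nbrSum G x v ≤ nbrSum G y v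
  nbrSum-mono-≤ x≤y v = ∑-mono-≤ (λ u → if-mono-≤ (Adj G v u) (x≤y u))

  nbrSum-const : ∀ c v → nbrSum G (λ _ → c) v ≡ c * degree G v
  nbrSum-const c v =
    trans (∑-cong (λ u → if-as-* (Adj G v u) c)) (sym (∑-distribˡ-* c (λ u → if Adj G v u then 1 else 0)))

  term≤nbrSum : ∀ x {v u} → T (Adj G v u) → x u ≤ nbrSum G x v
  term≤nbrSum x {v} {u} v~u =
    subst (_≤ nbrSum G x v) (if-T v~u) (term≤∑ (λ w → if Adj G v w then x w else 0) u)

  nbrSum-positive : ∀ x v → 0 < nbrSum G x v → ∃[ u ] T (Adj G v u) × 0 < x u
  nbrSum-positive x v 0<sum =
    let u , 0<term = ∑-positive _ 0<sum in u , if-positive (Adj G v u) 0<term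

  activeNbrs≡nbrSum : ∀ f v → activeNbrs G f v ≡ nbrSum G (indicator (support f)) v
  activeNbrs≡nbrSum f v = ∑-cong (λ u → if-∧ (Adj G v u))

  module _ {r : ℕ} (symmetric : IsSymmetric G) (regular : IsRegular r G) where

    ∑-nbrSum : ∀ x → ∑ (nbrSum G x) ≡ r * ∑ x
    ∑-nbrSum x = begin
      ∑ (λ v → ∑ (λ u → if Adj G v u then x u else 0))
        ≡⟨ ∑-comm (λ v u → if Adj G v u then x u else 0) ⟩
      ∑ (λ u → ∑ (λ v → if Adj G v u then x u else 0))
        ≡⟨ ∑-cong (λ u → ∑-cong (λ v → if-cong (symmetric v u))) ⟩
      ∑ (λ u → ∑ (λ v → if Adj G u v then x u else 0))
        ≡⟨ ∑-cong (λ u → trans (nbrSum-const (x u) u) (cong (x u *_) (regular u))) ⟩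
      ∑ (λ u → x u * r)
        ≡⟨ ∑-cong (λ u → *-comm (x u) r) ⟩
      ∑ (λ u → r * x u)
        ≡⟨ ∑-distribˡ-* r x ⟨
      r * ∑ x ∎
      where open ≡-Reasoning

    ∑-closedNbhdSum : ∀ x → ∑ (closedNbhdSum G x) ≡ suc r * ∑ x
    ∑-closedNbhdSum x = trans (∑-distrib-+ x (nbrSum G x)) (cong (∑ x +_) (∑-nbrSum x))

-- The weight of a [k]-RDF on a regular graph

m+n≤m*n : ∀ {m n} → 2 ≤ m → 2 ≤ n → m + n ≤ m * n
m+n≤m*n {suc (suc m)} {suc (suc n)} (s≤s (s≤s z≤n)) (s≤s (s≤s z≤n)) =
  subst (2 + m + (2 + n) ≤_) (sym (expand m n)) (m≤m+n _ _)
  where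
  expand : ∀ m n → (2 + m) * (2 + n) ≡ 2 + m + (2 + n) + (m + n + m * n)
  expand = solve-∀

-- J lonely and A active neighbours of an unlabelled vertex whose neighbours carry total label S.
discharge-≤ : ∀ {r k J A S} → 2 ≤ r → 1 ≤ J → J ≤ A → k + A ≤ S → S + J ≤ suc k * A →
              r * suc k + J ≤ r * S
discharge-≤ {k = k} {A = 1} {S} _ (s≤s z≤n) (s≤s z≤n) k+1≤S S+1≤[1+k]*1 =
  contradiction 1+k≤S (<⇒≱ S<1+k)
  where
  1+k≤S : suc k ≤ S
  1+k≤S = subst (_≤ S) (+-comm k 1) k+1≤S
  S<1+k : S < suc k
  S<1+k = subst₂ _≤_ (+-comm S 1) (*-identityʳ (suc k)) S+1≤[1+k]*1
discharge-≤ {r} {k} {J} {A@(suc (suc _))} {S} 2≤r _ J≤A k+A≤S _ = begin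
  r * suc k + J       ≤⟨ +-monoʳ-≤ (r * suc k) J≤A ⟩
  r * suc k + A       ≡⟨ regroup r k A ⟩
  r * k + (r + A)     ≤⟨ +-monoʳ-≤ (r * k) (m+n≤m*n 2≤r (s≤s (s≤s z≤n))) ⟩
  r * k + r * A       ≡⟨ *-distribˡ-+ r k A ⟨
  r * (k + A)         ≤⟨ *-monoʳ-≤ r k+A≤S ⟩
  r * S               ∎
  where
  open ≤-Reasoning
  regroup : ∀ r k A → r * suc k + A ≡ r * k + (r + A)
  regroup = solve-∀

module LowerBound {G : Graph} {r : ℕ} (symmetric : IsSymmetric G) (regular : IsRegular r G) (2≤r : 2 ≤ r)
                  {k : ℕ} (1≤k : 1 ≤ k) {f : Fin (order G) → ℕ} (rdf : Is[k]RDF k G f) where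

  open NeighbourSums G

  isLonely : Fin (order G) → Bool
  isLonely u = (f u ≡ᵇ k) ∧ (nbrSum G f u ≡ᵇ 0)

  lonely : Fin (order G) → ℕ
  lonely = indicator isLonely

  active : Fin (order G) → ℕ
  active = indicator (support f)

  isLonely-reflects : ∀ u → Reflects (f u ≡ k × nbrSum G f u ≡ 0) (isLonely u)
  isLonely-reflects u = ≡ᵇ-reflects (f u) k ×-reflects ≡ᵇ-reflects (nbrSum G f u) 0

  active≡1 : ∀ {u} → 0 < f u → active u ≡ 1
  active≡1 0<fu = if-T (<⇒<ᵇ 0<fu)

  lonely≤active : ∀ u → lonely u ≤ active u
  lonely≤active u with isLonely u | isLonely-reflects u
  ... | false | _              = z≤n
  ... | true  | ofʸ (fu≡k , _) = ≤-reflexive (sym (active≡1 (subst (0 <_) (sym fu≡k) 1≤k)))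

  label≤active : ∀ u → f u ≤ suc k * active u
  label≤active u with f u | proj₁ rdf u
  ... | zero  | _        = z≤n
  ... | suc l | l<1+k    = subst (suc l ≤_) (sym (*-identityʳ (suc k))) l<1+k

  label+lonely≤active : ∀ u → f u + lonely u ≤ suc k * active u
  label+lonely≤active u with isLonely u | isLonely-reflects u
  ... | false | _              = subst (_≤ suc k * active u) (sym (+-identityʳ (f u))) (label≤active u)
  ... | true  | ofʸ (fu≡k , _) = ≤-reflexive (begin
    f u + 1          ≡⟨ cong (_+ 1) fu≡k ⟩
    k + 1            ≡⟨ +-comm k 1 ⟩
    suc k            ≡⟨ *-identityʳ (suc k) ⟨
    suc k * 1        ≡⟨ cong (suc k *_) (active≡1 (subst (0 <_) (sym fu≡k) 1≤k)) ⟨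
    suc k * active u ∎)
    where open ≡-Reasoning

  nbrSum-label+lonely≤ : ∀ v → nbrSum G f v + nbrSum G lonely v ≤ suc k * nbrSum G active v
  nbrSum-label+lonely≤ v = begin
    nbrSum G f v + nbrSum G lonely v     ≡⟨ nbrSum-distrib-+ f lonely v ⟨
    nbrSum G (λ u → f u + lonely u) v    ≤⟨ nbrSum-mono-≤ label+lonely≤active v ⟩
    nbrSum G (λ u → suc k * active u) v  ≡⟨ nbrSum-distribˡ-* (suc k) active v ⟨
    suc k * nbrSum G active v            ∎
    where open ≤-Reasoning

  inactive⇒unlabelled : ∀ v → nbrSum G active v ≡ 0 → nbrSum G f v ≡ 0
  inactive⇒unlabelled v A≡0 = n≤0⇒n≡0 (begin
    nbrSum G f v                      ≤⟨ m≤m+n _ _ ⟩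
    nbrSum G f v + nbrSum G lonely v  ≤⟨ nbrSum-label+lonely≤ v ⟩
    suc k * nbrSum G active v         ≡⟨ cong (suc k *_) A≡0 ⟩
    suc k * 0                         ≡⟨ *-zeroʳ (suc k) ⟩
    0                                 ∎)
    where open ≤-Reasoning

  nbr-of-lonely-unlabelled : ∀ {u v} → T (isLonely u) → T (Adj G v u) → f v ≡ 0
  nbr-of-lonely-unlabelled {u} {v} lonely-u v~u with isLonely u | isLonely-reflects u
  ... | true | ofʸ (_ , nbrSum≡0) =
    n≤0⇒n≡0 (subst (f v ≤_) nbrSum≡0 (term≤nbrSum f (subst T (symmetric v u) v~u)))

  [k]RDF-condition : ∀ v → f v < k → k + nbrSum G active v ≤ closedNbhdSum G f v
  [k]RDF-condition v fv<k = subst (λ a → k + a ≤ closedNbhdSum G f v) (activeNbrs≡nbrSum f v) (proj₂ rdf v fv<k)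

  1+k≤closed : ∀ v → f v < k → suc k ≤ closedNbhdSum G f v
  1+k≤closed v fv<k with nbrSum G active v in A≡ | [k]RDF-condition v fv<k
  ... | zero  | k+0≤closed =
    contradiction (subst₂ _≤_ (+-identityʳ k) (cong (f v +_) (inactive⇒unlabelled v A≡)) k+0≤closed)
                  (<⇒≱ (subst (_< k) (sym (+-identityʳ (f v))) fv<k))
  ... | suc a | k+a+1≤closed = ≤-trans (subst (suc k ≤_) (sym (+-suc k a)) (s≤s (m≤m+n k a))) k+a+1≤closed

  1+k≤closed+lonely : ∀ v → suc k ≤ closedNbhdSum G f v + lonely v
  1+k≤closed+lonely v with <-cmp (f v) k
  ... | tri< fv<k _ _ = ≤-trans (1+k≤closed v fv<k) (m≤m+n _ _)
  ... | tri> _ _ k<fv = ≤-trans k<fv (≤-trans (m≤m+n (f v) _) (m≤m+n _ _))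
  ... | tri≈ _ fv≡k _ with isLonely v | isLonely-reflects v
  ...   | true  | _           = subst (_≤ closedNbhdSum G f v + 1) (+-comm k 1)
                                  (+-monoˡ-≤ 1 (subst (_≤ closedNbhdSum G f v) fv≡k (m≤m+n (f v) _)))
  ...   | false | ofⁿ ¬lonely = subst (_≤ closedNbhdSum G f v + 0) (+-comm k 1)
                                  (≤-trans (+-mono-≤ (≤-reflexive (sym fv≡k)) 1≤nbrSum) (m≤m+n _ 0))
    where
    1≤nbrSum : 1 ≤ nbrSum G f v
    1≤nbrSum = n≢0⇒n>0 (λ nbrSum≡0 → ¬lonely (fv≡k , nbrSum≡0))

  discharging : ∀ v → r * suc k + nbrSum G lonely v ≤ r * (closedNbhdSum G f v + lonely v)
  discharging v with nbrSum G lonely v in J≡ | nbrSum-mono-≤ lonely≤active v | nbrSum-label+lonely≤ v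
  ... | zero  | _ | _ = subst (_≤ r * (closedNbhdSum G f v + lonely v)) (sym (+-identityʳ (r * suc k)))
                          (*-monoʳ-≤ r (1+k≤closed+lonely v))
  ... | suc j | J≤A | S+J≤[1+k]*A with nbrSum-positive lonely v (subst (0 <_) (sym J≡) z<s)
  ...   | u , v~u , 0<lonely-u =
    ≤-trans (discharge-≤ 2≤r (s≤s z≤n) J≤A k+A≤S S+J≤[1+k]*A)
            (*-monoʳ-≤ r (≤-trans (m≤n+m _ (f v)) (m≤m+n _ _)))
    where
    fv≡0 : f v ≡ 0
    fv≡0 = nbr-of-lonely-unlabelled (proj₁ (if-positive (isLonely u) 0<lonely-u)) v~u
    k+A≤S : k + nbrSum G active v ≤ nbrSum G f v
    k+A≤S = subst (λ x → k + nbrSum G active v ≤ x + nbrSum G f v) fv≡0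
              ([k]RDF-condition v (subst (_< k) (sym fv≡0) 1≤k))

  weight-lower-bound : suc k * order G ≤ suc r * weight G f
  weight-lower-bound = +-cancelʳ-≤ L _ _ (*-cancelˡ-≤ r {{>-nonZero (≤-trans (s≤s z≤n) 2≤r)}} (begin
    r * (suc k * order G + L)                       ≡⟨ total-demand ⟨
    ∑ (λ v → r * suc k + nbrSum G lonely v)         ≤⟨ ∑-mono-≤ discharging ⟩
    ∑ (λ v → r * (closedNbhdSum G f v + lonely v))  ≡⟨ total-supply ⟩
    r * (suc r * weight G f + L)                    ∎))
    where
    open ≤-Reasoning
    L : ℕ
    L = ∑ lonely
    total-demand : ∑ (λ v → r * suc k + nbrSum G lonely v) ≡ r * (suc k * order G + L)
    total-demand = trans (∑-distrib-+ (λ _ → r * suc k) (nbrSum G lonely))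
      (trans (cong₂ _+_ (∑-const (order G) (r * suc k)) (∑-nbrSum symmetric regular lonely))
             (regroup (order G) r k L))
      where
      regroup : ∀ N r k L → N * (r * suc k) + r * L ≡ r * (suc k * N + L)
      regroup = solve-∀
    total-supply : ∑ (λ v → r * (closedNbhdSum G f v + lonely v)) ≡ r * (suc r * weight G f + L)
    total-supply = trans (sym (∑-distribˡ-* r (λ v → closedNbhdSum G f v + lonely v)))
      (cong (r *_) (trans (∑-distrib-+ (closedNbhdSum G f) lonely)
                          (cong (_+ L) (∑-closedNbhdSum symmetric regular f))))

-- Perfect codes

k+d≤[1+k]*d : ∀ k {d} → 1 ≤ d → k + d ≤ suc k * d
k+d≤[1+k]*d k {d} 1≤d = subst (_≤ d + k * d) (+-comm d k) (+-monoʳ-≤ d (m≤m*n k d {{>-nonZero 1≤d}}))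

romanOf : ∀ {N} → ℕ → (Fin N → Bool) → Fin N → ℕ
romanOf k D v = if D v then suc k else 0

IsPerfectCode : (G : Graph) → (Fin (order G) → Bool) → Set
IsPerfectCode G D = ∀ v → closedNbhdSum G (indicator D) v ≡ 1

module Codes (G : Graph) where

  open NeighbourSums G

  dominating⇒nbr-in-D : ∀ D → IsDominating G D → ∀ v → D v ≡ false → 1 ≤ nbrSum G (indicator D) v
  dominating⇒nbr-in-D D dom v Dv≡false with dom v
  ... | inj₁ Dv              = contradiction (subst T Dv≡false Dv) λ ()
  ... | inj₂ (u , v~u , Du)  = subst (_≤ nbrSum G (indicator D) v) (if-T Du) (term≤nbrSum (indicator D) v~u)

  weight-romanOf : ∀ k D → weight G (romanOf k D) ≡ suc k * card D
  weight-romanOf k D = trans (∑-cong (λ v → if-as-* (D v) (suc k))) (sym (∑-distribˡ-* (suc k) (indicator D)))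

  romanOf-[k]RDF : ∀ k D → IsDominating G D → Is[k]RDF k G (romanOf k D)
  romanOf-[k]RDF k D dom = bounded , condition
    where
    bounded : ∀ v → romanOf k D v ≤ suc k
    bounded v with D v
    ... | true  = ≤-refl
    ... | false = z≤n
    support-romanOf : ∀ u → indicator (support (romanOf k D)) u ≡ indicator D u
    support-romanOf u with D u
    ... | true  = refl
    ... | false = refl
    condition : ∀ v → romanOf k D v < k → k + activeNbrs G (romanOf k D) v ≤ closedNbhdSum G (romanOf k D) v
    condition v 1+k<k with D v in Dv≡
    ... | true  = contradiction 1+k<k (<-asym (n<1+n k))
    ... | false = begin
      k + activeNbrs G (romanOf k D) v          ≡⟨ cong (k +_) (activeNbrs≡nbrSum (romanOf k D) v) ⟩
      k + nbrSum G (indicator (support (romanOf k D))) v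
                                                ≡⟨ cong (k +_) (nbrSum-cong support-romanOf v) ⟩
      k + nbrSum G (indicator D) v              ≤⟨ k+d≤[1+k]*d k (dominating⇒nbr-in-D D dom v Dv≡) ⟩
      suc k * nbrSum G (indicator D) v          ≡⟨ nbrSum-distribˡ-* (suc k) (indicator D) v ⟩
      nbrSum G (λ u → suc k * indicator D u) v  ≡⟨ nbrSum-cong (λ u → if-as-* (D u) (suc k)) v ⟨
      nbrSum G (romanOf k D) v                  ∎
      where open ≤-Reasoning

  perfectCode⇒dominating : ∀ D → IsPerfectCode G D → IsDominating G D
  perfectCode⇒dominating D perfect v with D v in Dv≡
  ... | true  = inj₁ tt
  ... | false = let u , v~u , 0<Du = nbrSum-positive (indicator D) v 0<nbrSum in
                inj₂ (u , v~u , proj₁ (if-positive (D u) 0<Du))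
    where
    0<nbrSum : 0 < nbrSum G (indicator D) v
    0<nbrSum = ≤-reflexive (sym (subst (λ b → (if b then 1 else 0) + nbrSum G (indicator D) v ≡ 1)
                                       Dv≡ (perfect v)))

  perfectCode-card : ∀ {r} D → IsSymmetric G → IsRegular r G → IsPerfectCode G D → suc r * card D ≡ order G
  perfectCode-card {r} D symmetric regular perfect = begin
    suc r * card D                          ≡⟨ ∑-closedNbhdSum symmetric regular (indicator D) ⟨
    ∑ (closedNbhdSum G (indicator D))       ≡⟨ ∑-cong perfect ⟩
    ∑ {order G} (λ _ → 1)                   ≡⟨ ∑-const (order G) 1 ⟩
    order G * 1                             ≡⟨ *-identityʳ (order G) ⟩
    order G                                 ∎
    where open ≡-Reasoning

  perfectCode⇒domination-numbers : ∀ {r k} D → IsSymmetric G → IsRegular r G → 2 ≤ r → 1 ≤ k →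
    IsPerfectCode G D →
    [k]RomanDominationNumber k G (suc k * card D) × DominationNumber G (card D)
  perfectCode⇒domination-numbers {r} {k} D symmetric regular 2≤r 1≤k perfect =
    ((romanOf k D , romanOf-[k]RDF k D dominating , weight-romanOf k D) , roman-minimal) ,
    ((D , dominating , refl) , domination-minimal)
    where
    dominating : IsDominating G D
    dominating = perfectCode⇒dominating D perfect
    roman-minimal : ∀ f → Is[k]RDF k G f → suc k * card D ≤ weight G f
    roman-minimal f rdf = *-cancelˡ-≤ (suc r) (begin
      suc r * (suc k * card D)  ≡⟨ swap-factors (suc r) (suc k) (card D) ⟩
      suc k * (suc r * card D)  ≡⟨ cong (suc k *_) (perfectCode-card D symmetric regular perfect) ⟩
      suc k * order G           ≤⟨ LowerBound.weight-lower-bound symmetric regular 2≤r 1≤k rdf ⟩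
      suc r * weight G f        ∎)
      where
      open ≤-Reasoning
      swap-factors : ∀ a b c → a * (b * c) ≡ b * (a * c)
      swap-factors = solve-∀
    domination-minimal : ∀ D′ → IsDominating G D′ → card D ≤ card D′
    domination-minimal D′ dominating′ = *-cancelˡ-≤ (suc k)
      (subst (suc k * card D ≤_) (weight-romanOf k D′) (roman-minimal _ (romanOf-[k]RDF k D′ dominating′)))

-- Cartesian products and cycles

module CartesianProduct (G H : Graph) where

  private
    VG VH : Set
    VG = Fin (order G)
    VH = Fin (order H)

  quotRem-combine : ∀ (g : VG) (h : VH) → quotRem (order H) (combine g h) ≡ (h , g)
  quotRem-combine g h = cong swap (remQuot-combine g h)

  □-induction : {P : Fin (order (G □ H)) → Set} → (∀ (g : VG) (h : VH) → P (combine g h)) → ∀ v → P v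
  □-induction {P} p v = subst P (combine-remQuot {order G} (order H) v) (p _ _)

  □-induction₂ : {P : Fin (order (G □ H)) → Fin (order (G □ H)) → Set} →
                 (∀ (g : VG) (h : VH) g′ h′ → P (combine g h) (combine g′ h′)) → ∀ v w → P v w
  □-induction₂ {P} p v w = □-induction {λ v → P v w} (λ g h → □-induction {P (combine g h)} (p g h) w) v

  Adj-□ : ∀ (g : VG) (h : VH) g′ h′ →
          Adj (G □ H) (combine g h) (combine g′ h′)
          ≡ ((g =ᵇ g′) ∧ Adj H h h′) ∨ ((h =ᵇ h′) ∧ Adj G g g′)
  Adj-□ g h g′ h′ rewrite quotRem-combine g h | quotRem-combine g′ h′ = refl

  □-symmetric : IsSymmetric G → IsSymmetric H → IsSymmetric (G □ H)
  □-symmetric symmetricG symmetricH = □-induction₂ λ g h g′ h′ → begin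
    Adj (G □ H) (combine g h) (combine g′ h′)
      ≡⟨ Adj-□ g h g′ h′ ⟩
    ((g =ᵇ g′) ∧ Adj H h h′) ∨ ((h =ᵇ h′) ∧ Adj G g g′)
      ≡⟨ cong₂ _∨_ (cong₂ _∧_ (≡ᵇ-sym (toℕ g) (toℕ g′)) (symmetricH h h′))
                   (cong₂ _∧_ (≡ᵇ-sym (toℕ h) (toℕ h′)) (symmetricG g g′)) ⟩
    ((g′ =ᵇ g) ∧ Adj H h′ h) ∨ ((h′ =ᵇ h) ∧ Adj G g′ g)
      ≡⟨ Adj-□ g′ h′ g h ⟨
    Adj (G □ H) (combine g′ h′) (combine g h) ∎
    where open ≡-Reasoning

  nbrSum-□ : IsLoopless G → ∀ x (g : VG) (h : VH) →
             nbrSum (G □ H) x (combine g h)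
             ≡ nbrSum H (λ h′ → x (combine g h′)) h + nbrSum G (λ g′ → x (combine g′ h)) g
  nbrSum-□ loopless x g h = begin
    nbrSum (G □ H) x (combine g h)
      ≡⟨ ∑-combine {order G} {order H} (λ w → if Adj (G □ H) (combine g h) w then x w else 0) ⟩
    ∑ (λ g′ → ∑ (λ h′ → if Adj (G □ H) (combine g h) (combine g′ h′) then X g′ h′ else 0))
      ≡⟨ ∑-cong (λ g′ → trans (∑-cong (split g′)) (∑-distrib-+ (A g′) (B g′))) ⟩
    ∑ (λ g′ → ∑ (A g′) + ∑ (B g′))
      ≡⟨ ∑-distrib-+ (λ g′ → ∑ (A g′)) (λ g′ → ∑ (B g′)) ⟩
    ∑ (λ g′ → ∑ (A g′)) + ∑ (λ g′ → ∑ (B g′))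
      ≡⟨ cong₂ _+_ (∑-=ᵇ-∧ g (Adj H h) X) (trans (∑-comm B) (∑-=ᵇ-∧ h (Adj G g) (flip X))) ⟩
    nbrSum H (X g) h + nbrSum G (λ g′ → X g′ h) g ∎
    where
    open ≡-Reasoning
    X : VG → VH → ℕ
    X g′ h′ = x (combine g′ h′)
    A B : VG → VH → ℕ
    A g′ h′ = if (g =ᵇ g′) ∧ Adj H h h′ then X g′ h′ else 0
    B g′ h′ = if (h =ᵇ h′) ∧ Adj G g g′ then X g′ h′ else 0
    disjoint : ∀ g′ h′ → ((g =ᵇ g′) ∧ Adj H h h′) ∧ ((h =ᵇ h′) ∧ Adj G g g′) ≡ false
    disjoint g′ h′ with g =ᵇ g′ | =ᵇ-reflects g g′
    ... | false | _        = refl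
    ... | true  | ofʸ refl rewrite loopless g | ∧-zeroʳ (h =ᵇ h′) = ∧-zeroʳ (Adj H h h′)
    split : ∀ g′ h′ → (if Adj (G □ H) (combine g h) (combine g′ h′) then X g′ h′ else 0) ≡ A g′ h′ + B g′ h′
    split g′ h′ = trans (if-cong (Adj-□ g h g′ h′))
      (if-∨-disjoint ((g =ᵇ g′) ∧ Adj H h h′) ((h =ᵇ h′) ∧ Adj G g g′) (disjoint g′ h′))

  □-regular : ∀ {r s} → IsLoopless G → IsRegular r G → IsRegular s H → IsRegular (s + r) (G □ H)
  □-regular loopless regularG regularH =
    □-induction λ g h → trans (nbrSum-□ loopless (λ _ → 1) g h) (cong₂ _+_ (regularH h) (regularG g))

module Cycle (m-3 : ℕ) where

  private
    M : ℕ
    M = suc (suc m-3)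

  -- `cycAdj i j` unfolds to `step (toℕ i) (toℕ j) ∨ step (toℕ j) (toℕ i)`.
  step : ℕ → ℕ → Bool
  step a b = (b ≡ᵇ suc a) ∨ ((a ≡ᵇ M) ∧ (b ≡ᵇ 0))

  nextℕ : ℕ → ℕ
  nextℕ a = if a ≡ᵇ M then 0 else suc a

  prevℕ : ℕ → ℕ
  prevℕ zero    = M
  prevℕ (suc a) = a

  nextℕ< : ∀ {a} → a < suc M → nextℕ a < suc M
  nextℕ< {a} a<m with a ≡ᵇ M | ≡ᵇ-reflects a M
  ... | true  | _       = z<s
  ... | false | ofⁿ a≢M = s≤s (≤∧≢⇒< (≤-pred a<m) a≢M)

  prevℕ< : ∀ {a} → a < suc M → prevℕ a < suc M
  prevℕ< {zero}  _   = n<1+n M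
  prevℕ< {suc a} a<m = <-trans (n<1+n a) a<m

  next prev : Fin (suc M) → Fin (suc M)
  next i = fromℕ< (nextℕ< (toℕ<n i))
  prev i = fromℕ< (prevℕ< (toℕ<n i))

  toℕ-next : ∀ i → toℕ (next i) ≡ nextℕ (toℕ i)
  toℕ-next i = toℕ-fromℕ< (nextℕ< (toℕ<n i))

  toℕ-prev : ∀ i → toℕ (prev i) ≡ prevℕ (toℕ i)
  toℕ-prev i = toℕ-fromℕ< (prevℕ< (toℕ<n i))

  step≡next : ∀ a {b} → b < suc M → step a b ≡ (nextℕ a ≡ᵇ b)
  step≡next a {b} b<m with a ≡ᵇ M | ≡ᵇ-reflects a M
  ... | true  | ofʸ refl rewrite ≢⇒≡ᵇ≡false (<⇒≢ b<m) = ≡ᵇ-sym b 0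
  ... | false | _        = trans (∨-identityʳ (b ≡ᵇ suc a)) (≡ᵇ-sym b (suc a))

  next≡-prev≡ : ∀ {a} b → a < suc M → (nextℕ b ≡ᵇ a) ≡ (prevℕ a ≡ᵇ b)
  next≡-prev≡ {a} b a<m with b ≡ᵇ M | ≡ᵇ-reflects b M
  next≡-prev≡ {zero}  b _   | true  | ofʸ refl = sym (≡ᵇ-refl M)
  next≡-prev≡ {suc a} b a<m | true  | ofʸ refl = sym (≢⇒≡ᵇ≡false (<⇒≢ (≤-pred a<m)))
  next≡-prev≡ {zero}  b _   | false | ofⁿ b≢M  = sym (≢⇒≡ᵇ≡false (b≢M ∘ sym))
  next≡-prev≡ {suc a} b _   | false | _        = ≡ᵇ-sym b a

  cycAdj≡ : ∀ (i j : Fin (suc M)) → cycAdj i j ≡ (next i =ᵇ j) ∨ (prev i =ᵇ j)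
  cycAdj≡ i j rewrite toℕ-next i | toℕ-prev i =
    cong₂ _∨_ (step≡next (toℕ i) (toℕ<n j))
              (trans (step≡next (toℕ j) (toℕ<n i)) (next≡-prev≡ (toℕ j) (toℕ<n i)))

  nextℕ≢prevℕ : ∀ a → nextℕ a ≢ prevℕ a
  nextℕ≢prevℕ zero    = λ ()
  nextℕ≢prevℕ (suc a) with suc a ≡ᵇ M | ≡ᵇ-reflects (suc a) M
  ... | true  | ofʸ refl = λ ()
  ... | false | _        = λ 2+a≡a → <⇒≢ (<-trans (n<1+n a) (n<1+n (suc a))) (sym 2+a≡a)

  next≢prev : ∀ i → next i ≢ prev i
  next≢prev i next≡prev =
    nextℕ≢prevℕ (toℕ i) (trans (sym (toℕ-next i)) (trans (cong toℕ next≡prev) (toℕ-prev i)))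

  step-irrefl : ∀ a → step a a ≡ false
  step-irrefl zero    = refl
  step-irrefl (suc a) = cong₂ _∨_ (≢⇒≡ᵇ≡false {a} (1+n≢n ∘ sym)) (∧-zeroʳ (suc a ≡ᵇ M))

  loopless : IsLoopless (C (suc M))
  loopless i = cong₂ _∨_ (step-irrefl (toℕ i)) (step-irrefl (toℕ i))

  symmetric : IsSymmetric (C (suc M))
  symmetric i j = ∨-comm (step (toℕ i) (toℕ j)) (step (toℕ j) (toℕ i))

  nbrSum-C : ∀ z i → nbrSum (C (suc M)) z i ≡ z (next i) + z (prev i)
  nbrSum-C z i = begin
    ∑ (λ j → if cycAdj i j then z j else 0)
      ≡⟨ ∑-cong (λ j → trans (if-cong (cycAdj≡ i j))
                              (if-∨-disjoint (next i =ᵇ j) (prev i =ᵇ j) {z j} (=ᵇ-disjoint (next≢prev i) j))) ⟩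
    ∑ (λ j → (if next i =ᵇ j then z j else 0) + (if prev i =ᵇ j then z j else 0))
      ≡⟨ ∑-distrib-+ (λ j → if next i =ᵇ j then z j else 0) (λ j → if prev i =ᵇ j then z j else 0) ⟩
    ∑ (λ j → if next i =ᵇ j then z j else 0) + ∑ (λ j → if prev i =ᵇ j then z j else 0)
      ≡⟨ cong₂ _+_ (∑-=ᵇ (next i) z) (∑-=ᵇ (prev i) z) ⟩
    z (next i) + z (prev i) ∎
    where open ≡-Reasoning

  regular : IsRegular 2 (C (suc M))
  regular = nbrSum-C (λ _ → 1)

  module _ (d : ℕ) .{{_ : NonZero d}} (d∣m : d ∣ suc M) where

    toℕ-next-mod : ∀ i → toℕ (next i) % d ≡ suc (toℕ i) % d
    toℕ-next-mod i rewrite toℕ-next i = nextℕ-mod (toℕ i)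
      where
      nextℕ-mod : ∀ a → nextℕ a % d ≡ suc a % d
      nextℕ-mod a with a ≡ᵇ M | ≡ᵇ-reflects a M
      ... | true  | ofʸ refl = trans (m<n⇒m%n≡m (>-nonZero⁻¹ d)) (sym (n∣m⇒m%n≡0 (suc M) d d∣m))
      ... | false | _        = refl

    toℕ-prev-mod : ∀ i → toℕ (prev i) % d ≡ (toℕ i + pred d) % d
    toℕ-prev-mod i rewrite toℕ-prev i = prevℕ-mod (toℕ i)
      where
      prevℕ-mod : ∀ a → prevℕ a % d ≡ (a + pred d) % d
      prevℕ-mod zero    = trans (%-pred-≡0 (n∣m⇒m%n≡0 (suc M) d d∣m))
                                (sym (m<n⇒m%n≡m (subst (pred d <_) (suc-pred d) ≤-refl)))
      prevℕ-mod (suc a) = begin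
        a % d                   ≡⟨ [m+n]%n≡m%n a d ⟨
        (a + d) % d             ≡⟨ cong (λ x → (a + x) % d) (suc-pred d) ⟨
        (a + suc (pred d)) % d  ≡⟨ cong (_% d) (+-suc a (pred d)) ⟩
        (suc a + pred d) % d    ∎
        where open ≡-Reasoning

-- The torus C_m □ C_n

𝟙[5∣_] : ℕ → ℕ
𝟙[5∣ x ] = if x % 5 ≡ᵇ 0 then 1 else 0

-- `(5 + x) % 5` reduces to `x % 5`, so the last clause is well typed as it stands.
five-consecutive : ∀ s → 𝟙[5∣ s ] + ((𝟙[5∣ s + 2 ] + 𝟙[5∣ s + 3 ]) + (𝟙[5∣ s + 1 ] + 𝟙[5∣ s + 4 ])) ≡ 1
five-consecutive 0 = refl
five-consecutive 1 = refl
five-consecutive 2 = refl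
five-consecutive 3 = refl
five-consecutive 4 = refl
five-consecutive (suc (suc (suc (suc (suc s))))) = five-consecutive s

module Torus (m-3 n-3 : ℕ) where

  private
    module Cₘ = Cycle m-3
    module Cₙ = Cycle n-3

  m n : ℕ
  m = 3 + m-3
  n = 3 + n-3

  open CartesianProduct (C m) (C n)

  torus : Graph
  torus = C m □ C n

  torus-symmetric : IsSymmetric torus
  torus-symmetric = □-symmetric Cₘ.symmetric Cₙ.symmetric

  torus-regular : IsRegular 4 torus
  torus-regular = □-regular Cₘ.loopless Cₘ.regular Cₙ.regular

  nbrSum-torus : ∀ x (g : Fin m) (h : Fin n) →
    nbrSum torus x (combine g h) ≡ (x (combine g (Cₙ.next h)) + x (combine g (Cₙ.prev h)))
                                 + (x (combine (Cₘ.next g) h) + x (combine (Cₘ.prev g) h))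
  nbrSum-torus x g h = trans (nbrSum-□ Cₘ.loopless x g h)
    (cong₂ _+_ (Cₙ.nbrSum-C (λ h′ → x (combine g h′)) h) (Cₘ.nbrSum-C (λ g′ → x (combine g′ h)) g))

  label : Fin m → Fin n → ℕ
  label g h = toℕ g + 2 * toℕ h

  code : Fin (m * n) → Bool
  code v = uncurry (λ g h → label g h % 5 ≡ᵇ 0) (remQuot n v)

  𝟙code : ∀ g h c → label g h % 5 ≡ c % 5 → indicator code (combine g h) ≡ 𝟙[5∣ c ]
  𝟙code g h c label≡c =
    trans (if-cong (cong (uncurry (λ g h → label g h % 5 ≡ᵇ 0)) (remQuot-combine g h)))
          (cong (λ x → if x ≡ᵇ 0 then 1 else 0) label≡c)

  label-mod : ∀ g h a b → toℕ g % 5 ≡ a % 5 → toℕ h % 5 ≡ b % 5 → label g h % 5 ≡ (a + 2 * b) % 5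
  label-mod g h a b g≡a h≡b = begin
    (toℕ g + 2 * toℕ h) % 5              ≡⟨ %-distribˡ-+ (toℕ g) (2 * toℕ h) 5 ⟩
    (toℕ g % 5 + (2 * toℕ h) % 5) % 5    ≡⟨ cong₂ (λ x y → (x + y) % 5) g≡a 2h≡2b ⟩
    (a % 5 + (2 * b) % 5) % 5            ≡⟨ %-distribˡ-+ a (2 * b) 5 ⟨
    (a + 2 * b) % 5                      ∎
    where
    open ≡-Reasoning
    2h≡2b : (2 * toℕ h) % 5 ≡ (2 * b) % 5
    2h≡2b = trans (%-distribˡ-* 2 (toℕ h) 5) (trans (cong (λ y → (2 * y) % 5) h≡b) (sym (%-distribˡ-* 2 b 5)))

  module _ (5∣m : 5 ∣ m) (5∣n : 5 ∣ n) where

    open Codes torus using (perfectCode-card)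

    label-next-h : ∀ g h → label g (Cₙ.next h) % 5 ≡ (label g h + 2) % 5
    label-next-h g h = trans (label-mod g (Cₙ.next h) (toℕ g) (suc (toℕ h)) refl (Cₙ.toℕ-next-mod 5 5∣n h))
                             (cong (_% 5) (shift (toℕ g) (toℕ h)))
      where
      shift : ∀ a b → a + 2 * suc b ≡ a + 2 * b + 2
      shift = solve-∀

    label-prev-h : ∀ g h → label g (Cₙ.prev h) % 5 ≡ (label g h + 3) % 5
    label-prev-h g h = trans (label-mod g (Cₙ.prev h) (toℕ g) (toℕ h + 4) refl (Cₙ.toℕ-prev-mod 5 5∣n h))
                             (cong (_% 5) (shift (toℕ g) (toℕ h)))
      where
      -- `_% 5` discards the leading `5 +` definitionally.
      shift : ∀ a b → a + 2 * (b + 4) ≡ 5 + (a + 2 * b + 3)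
      shift = solve-∀

    label-next-g : ∀ g h → label (Cₘ.next g) h % 5 ≡ (label g h + 1) % 5
    label-next-g g h = trans (label-mod (Cₘ.next g) h (suc (toℕ g)) (toℕ h) (Cₘ.toℕ-next-mod 5 5∣m g) refl)
                             (cong (_% 5) (shift (toℕ g) (toℕ h)))
      where
      shift : ∀ a b → suc a + 2 * b ≡ a + 2 * b + 1
      shift = solve-∀

    label-prev-g : ∀ g h → label (Cₘ.prev g) h % 5 ≡ (label g h + 4) % 5
    label-prev-g g h = trans (label-mod (Cₘ.prev g) h (toℕ g + 4) (toℕ h) (Cₘ.toℕ-prev-mod 5 5∣m g) refl)
                             (cong (_% 5) (shift (toℕ g) (toℕ h)))
      where
      shift : ∀ a b → a + 4 + 2 * b ≡ a + 2 * b + 4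
      shift = solve-∀

    code-perfect : IsPerfectCode torus code
    code-perfect = □-induction perfect-at
      where
      perfect-at : ∀ g h → closedNbhdSum torus (indicator code) (combine g h) ≡ 1
      perfect-at g h = begin
        indicator code (combine g h) + nbrSum torus (indicator code) (combine g h)
          ≡⟨ cong (indicator code (combine g h) +_) (nbrSum-torus (indicator code) g h) ⟩
        indicator code (combine g h)
          + ((indicator code (combine g (Cₙ.next h)) + indicator code (combine g (Cₙ.prev h)))
            + (indicator code (combine (Cₘ.next g) h) + indicator code (combine (Cₘ.prev g) h)))
          ≡⟨ cong₂ _+_ (𝟙code g h s refl)
                       (cong₂ _+_ (cong₂ _+_ (𝟙code g (Cₙ.next h) (s + 2) (label-next-h g h))
                                             (𝟙code g (Cₙ.prev h) (s + 3) (label-prev-h g h)))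
                                  (cong₂ _+_ (𝟙code (Cₘ.next g) h (s + 1) (label-next-g g h))
                                             (𝟙code (Cₘ.prev g) h (s + 4) (label-prev-g g h)))) ⟩
        𝟙[5∣ s ] + ((𝟙[5∣ s + 2 ] + 𝟙[5∣ s + 3 ]) + (𝟙[5∣ s + 1 ] + 𝟙[5∣ s + 4 ]))
          ≡⟨ five-consecutive s ⟩
        1 ∎
        where
        open ≡-Reasoning
        s : ℕ
        s = label g h

    card-code : card code ≡ (m * n) / 5
    card-code = begin
      card code          ≡⟨ m*n/n≡m (card code) 5 ⟨
      card code * 5 / 5  ≡⟨ cong (_/ 5) (*-comm (card code) 5) ⟩
      5 * card code / 5  ≡⟨ cong (_/ 5) (perfectCode-card code torus-symmetric torus-regular code-perfect) ⟩
      (m * n) / 5        ∎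
      where open ≡-Reasoning

mainTheorem2 : (m n k : ℕ) → 5 ∣ m → 5 ∣ n → 3 ≤ m → 3 ≤ n → 1 ≤ k →
    [k]RomanDominationNumber k (C m □ C n) (suc k * ((m * n) / 5))
    × DominationNumber (C m □ C n) ((m * n) / 5)
mainTheorem2 (suc (suc (suc m-3))) (suc (suc (suc n-3))) k 5∣m 5∣n (s≤s (s≤s (s≤s _))) (s≤s (s≤s (s≤s _))) 1≤k =
  subst (λ c → [k]RomanDominationNumber k torus (suc k * c) × DominationNumber torus c) (card-code 5∣m 5∣n)
        (perfectCode⇒domination-numbers code torus-symmetric torus-regular (s≤s (s≤s z≤n)) 1≤k
                                        (code-perfect 5∣m 5∣n))
  where
  open Torus m-3 n-3
  open Codes torus using (perfectCode⇒domination-numbers)
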